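{- Let $k\ge 1$ be an integer and $n = \binom{k}{\lfloor k/2\rfloor} + 1$. Then $\mathrm{rank}_{\mathbb{B}}(C_n) = k+1$, and every proper sub-matrix of $C_n$ has Boolean rank at most $k$.
   Context: $C_n$ is the $n\times n$ $0,1$ matrix with zeros on the main diagonal and ones elsewhere. A sub-matrix is obtained by selecting a subset of rows and a subset of columns; it is proper if it is not the whole matrix. The Boolean rank $\mathrm{rank}_{\mathbb{B}}(M)$ of a $0,1$ matrix $M$ is the minimal $r$ with $M=A\cdot B$ for $0,1$ matrices $A,B$ of inner dimension $r$ under Boolean arithmetic ($1+1=1$); equivalently the minimum number of all-ones submatrices covering the $1$-entries of $M$. -}

module Defs where

open import Data.Nat using (ℕ; suc; _≤_)
open import Data.Bool using (Bool; true; false; _∧_; _∨_; not)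
open import Data.Fin using (Fin; _≟_)
open import Data.Fin.Subset using (Subset; _∈_; ⊤)
open import Data.Product using (Σ; ∃; ∃₂; _×_; _,_)
open import Relation.Nullary using (¬_)
open import Relation.Nullary.Decidable using (⌊_⌋)
open import Relation.Binary.PropositionalEquality using (_≡_)

Matrix : Set → Set → Set
Matrix I J = I → J → Bool

⋁ : (r : ℕ) → (Fin r → Bool) → Bool
⋁ ℕ.zero f = false
⋁ (suc r) f = f Fin.zero ∨ ⋁ r (λ t → f (Fin.suc t))

_·_ : ∀ {I J r} → Matrix I (Fin r) → Matrix (Fin r) J → Matrix I J
(A · B) i j = ⋁ _ (λ t → A i t ∧ B t j)

BoolFactorizable : ∀ {I J} → Matrix I J → ℕ → Set
BoolFactorizable {I} {J} M r =
  Σ (Matrix I (Fin r)) λ A → Σ (Matrix (Fin r) J) λ B → ∀ i j → M i j ≡ (A · B) i j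

BoolRank≤ : ∀ {I J} → Matrix I J → ℕ → Set
BoolRank≤ M r = Σ ℕ λ s → s ≤ r × BoolFactorizable M s

BoolRank≡ : ∀ {I J} → Matrix I J → ℕ → Set
BoolRank≡ M r = BoolFactorizable M r × (∀ s → BoolFactorizable M s → r ≤ s)

Cmat : (n : ℕ) → Matrix (Fin n) (Fin n)
Cmat n i j = not ⌊ i ≟ j ⌋

Elem : ∀ {n} → Subset n → Set
Elem {n} R = Σ (Fin n) λ i → i ∈ R

subMatrix : ∀ {m n} → Matrix (Fin m) (Fin n) → (R : Subset m) → (S : Subset n)
          → Matrix (Elem R) (Elem S)
subMatrix M R S (i , _) (j , _) = M i j

Proper : ∀ {m n} → Subset m → Subset n → Set
Proper R S = ¬ (R ≡ ⊤ × S ≡ ⊤)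

{-# OPTIONS --safe #-}
-- If C_n = A · B with inner dimension s, the rows of A form an antichain of subsets of [s]:
-- from A i ⊆ A j and a witness t of C i j = 1 we would get C j j = 1. Sperner's theorem,
-- proved through the LYM inequality, then gives n ≤ s C ⌊s/2⌋, and s C ⌊s/2⌋ is monotone in s.
-- Conversely an antichain T of n subsets of [k] gives C_n = T · Tᶜᵀ, since T i ∖ T j is
-- nonempty exactly when i ≠ j. For n = k C ⌊k/2⌋ + 1, the ⌈k/2⌉-subsets of [k] together with
-- the singleton of a new point factor C_n through k + 1 points. A proper sub-matrix misses
-- a row (or, by symmetry, a column), and that row can be given the empty set instead, so k
-- points suffice.

module Submission where

open import Defs
open import Data.Nat using (ℕ; zero; suc; _+_; _*_; _∸_; _≤_; _≤′_; ≤′-refl; ≤′-step; z≤n; s≤s; _!; _/_; ⌊_/2⌋; ⌈_/2⌉)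
open import Data.Nat.Properties
  using (+-*-semiring; *-commutativeSemigroup; module ≤-Reasoning; ≤-refl; ≤-reflexive; ≤-trans; ≤-total; ≤-pred;
         ≤⇒≤′; ≮⇒≥; 1+n≰n; <⇒≢; n<1+n; m≤m+n; m≤n+m; m≤n⇒m≤1+n; +-mono-≤; *-monoˡ-≤; *-cancelʳ-≤;
         +-comm; +-suc; +-identityʳ; *-comm; *-assoc; *-identityˡ; *-identityʳ; *-zeroʳ;
         +-∸-assoc; m+n∸m≡n; m∸n+n≡m; m+[n∸m]≡n; n∸n≡0; _!*_!≢0;
         ⌊n/2⌋≤n; ⌊n/2⌋<n; ⌊n/2⌋+⌈n/2⌉≡n; n≡⌊n+n/2⌋; n≡⌈n+n/2⌉)
open import Data.Nat.DivMod using (m/n≡1+[m∸n]/n; m/n*n≡m)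
open import Data.Nat.Combinatorics using (_C_; nCk≡n!/k![n-k]!; k![n∸k]!∣n!; nCk≡nC[n∸k]; nCk+nC[k+1]≡[n+1]C[k+1])
open import Algebra.Properties.Semiring.Sum +-*-semiring using (sum; sum-cong-≗; sum-replicate-zero; sum-remove; ∑-comm; ∑-distrib-+; *-distribʳ-sum)
open import Algebra.Properties.CommutativeSemigroup *-commutativeSemigroup using (x∙yz≈y∙xz)
open import Data.Bool using (Bool; true; false; not; _∧_; _∨_)
open import Data.Bool.Properties using (∧-inverseʳ; ∧-conicalˡ; ∧-conicalʳ; ¬-not; not-injective; ∨-zeroʳ)
import Data.Bool.Properties as Bool
open import Data.Fin using (Fin; zero; suc; punchIn; punchOut; splitAt; join; cast; _≟_)
open import Data.Fin.Properties using (all?; any?; ¬∀⟶∃¬; punchInᵢ≢i; punchIn-punchOut; join-splitAt; cast-involutive)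
import Data.Fin.Permutation.Components as Components
open import Data.Fin.Subset using (Subset; _∉_; ⊤)
open import Data.Fin.Subset.Properties using (_∈?_; ⊆-antisym; ⊆⊤)
open import Data.Vec.Functional using (_∷_; removeAt)
open import Data.Product using (∃; _×_; _,_)
import Data.Product as Product
open import Data.Sum using (_⊎_; inj₁; inj₂; [_,_]′)
open import Function using (_∘_; id)
open import Relation.Nullary using (¬_; yes; no; contradiction)
open import Relation.Nullary.Decidable using (_×-dec_)
open import Relation.Binary.PropositionalEquality

χ : Bool → ℕ
χ true  = 1
χ false = 0

∣_∣ : ∀ {n} → (Fin n → Bool) → ℕ
∣ a ∣ = sum (χ ∘ a)

_⊆_ : ∀ {n} → (Fin n → Bool) → (Fin n → Bool) → Set
a ⊆ b = ∀ x → a x ≡ true → b x ≡ true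

Full : ∀ {n} → (Fin n → Bool) → Set
Full a = ∀ x → a x ≡ true

Nonempty : ∀ {n} → (Fin n → Bool) → Set
Nonempty a = ∃ λ x → a x ≡ true

∅ : ∀ {n} → Fin n → Bool
∅ _ = false

Antichain : ∀ {n k} → (Fin n → Fin k → Bool) → Set
Antichain T = ∀ i j → T i ⊆ T j → i ≡ j

sum-mono-≤ : ∀ {n} {f g : Fin n → ℕ} → (∀ i → f i ≤ g i) → sum f ≤ sum g
sum-mono-≤ {zero}  f≤g = z≤n
sum-mono-≤ {suc n} f≤g = +-mono-≤ (f≤g zero) (sum-mono-≤ (f≤g ∘ suc))

sum-const : ∀ n c → sum {n} (λ _ → c) ≡ n * c
sum-const zero    c = refl
sum-const (suc n) c = cong (c +_) (sum-const n c)

sum-zero : ∀ {n} {f : Fin n → ℕ} → (∀ i → f i ≡ 0) → sum f ≡ 0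
sum-zero {n} f≡0 = trans (sum-cong-≗ f≡0) (trans (sum-const n 0) (*-zeroʳ n))

χ-mono : ∀ {b c} → (b ≡ true → c ≡ true) → χ b ≤ χ c
χ-mono {false} _   = z≤n
χ-mono {true}  b⇒c rewrite b⇒c refl = ≤-refl

χ+χ-not : ∀ b → χ b + χ (not b) ≡ 1
χ+χ-not true  = refl
χ+χ-not false = refl

∣∣+∣∁∣≡n : ∀ {n} (a : Fin n → Bool) → ∣ a ∣ + ∣ not ∘ a ∣ ≡ n
∣∣+∣∁∣≡n {n} a = begin
  ∣ a ∣ + ∣ not ∘ a ∣                  ≡⟨ ∑-distrib-+ (χ ∘ a) (χ ∘ not ∘ a) ⟨
  sum (λ x → χ (a x) + χ (not (a x)))  ≡⟨ sum-cong-≗ (χ+χ-not ∘ a) ⟩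
  sum {n} (λ _ → 1)                    ≡⟨ sum-const n 1 ⟩
  n * 1                                ≡⟨ *-identityʳ n ⟩
  n                                    ∎
  where open ≡-Reasoning

∣∁∣≡n∸∣∣ : ∀ {n} (a : Fin n → Bool) → ∣ not ∘ a ∣ ≡ n ∸ ∣ a ∣
∣∁∣≡n∸∣∣ a = trans (sym (m+n∸m≡n ∣ a ∣ _)) (cong (_∸ ∣ a ∣) (∣∣+∣∁∣≡n a))

∣∣≤n : ∀ {n} (a : Fin n → Bool) → ∣ a ∣ ≤ n
∣∣≤n a = subst (∣ a ∣ ≤_) (∣∣+∣∁∣≡n a) (m≤m+n ∣ a ∣ _)

∣full∣ : ∀ {n} {a : Fin n → Bool} → Full a → ∣ a ∣ ≡ n
∣full∣ {n} full = trans (sum-cong-≗ (cong χ ∘ full)) (trans (sum-const n 1) (*-identityʳ n))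

¬Full⇒∃false : ∀ {n} (a : Fin n → Bool) → ¬ Full a → ∃ λ x → a x ≡ false
¬Full⇒∃false a ¬full = Product.map₂ ¬-not (¬∀⟶∃¬ _ _ (λ x → a x Bool.≟ true) ¬full)

∣removeAt∣ : ∀ {n} (a : Fin (suc n) → Bool) x → a x ≡ false → ∣ removeAt a x ∣ ≡ ∣ a ∣
∣removeAt∣ a x ax≡false = sym (begin
  ∣ a ∣                        ≡⟨ sum-remove (χ ∘ a) ⟩
  χ (a x) + ∣ removeAt a x ∣  ≡⟨ cong (λ b → χ b + ∣ removeAt a x ∣) ax≡false ⟩
  ∣ removeAt a x ∣            ∎)
  where open ≡-Reasoning

⊆⇒∣∣≤ : ∀ {n} {a b : Fin n → Bool} → a ⊆ b → ∣ a ∣ ≤ ∣ b ∣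
⊆⇒∣∣≤ a⊆b = sum-mono-≤ (χ-mono ∘ a⊆b)

⊆∧∣∣≡⇒≗ : ∀ {n} {a b : Fin n → Bool} → a ⊆ b → ∣ a ∣ ≡ ∣ b ∣ → a ≗ b
⊆∧∣∣≡⇒≗ {zero} _ _ ()
⊆∧∣∣≡⇒≗ {suc n} {a} {b} a⊆b ∣a∣≡∣b∣ x with a x in ax | b x in bx
... | true  | true  = refl
... | false | false = refl
... | true  | false = contradiction (trans (sym (a⊆b x ax)) bx) λ ()
... | false | true  = contradiction ∣a∣≡∣b∣ (<⇒≢ (begin-strict
  ∣ a ∣                       ≡⟨ ∣removeAt∣ a x ax ⟨
  ∣ removeAt a x ∣            ≤⟨ ⊆⇒∣∣≤ (a⊆b ∘ punchIn x) ⟩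
  ∣ removeAt b x ∣            <⟨ n<1+n _ ⟩
  suc ∣ removeAt b x ∣        ≡⟨ cong (λ c → χ c + ∣ removeAt b x ∣) bx ⟨
  χ (b x) + ∣ removeAt b x ∣  ≡⟨ sum-remove (χ ∘ b) ⟨
  ∣ b ∣                       ∎))
  where open ≤-Reasoning

⊆-removeAt⁻ : ∀ {n} {a b : Fin (suc n) → Bool} {x} → a x ≡ false → removeAt a x ⊆ removeAt b x → a ⊆ b
⊆-removeAt⁻ {a = a} {b} {x} ax≡false sub y ay≡true with x ≟ y
... | yes refl = contradiction (trans (sym ay≡true) ax≡false) λ ()
... | no x≢y   = subst (λ z → b z ≡ true) (punchIn-punchOut x≢y)
                   (sub (punchOut x≢y) (subst (λ z → a z ≡ true) (sym (punchIn-punchOut x≢y)) ay≡true))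

∁⊆∁⇒⊇ : ∀ {n} {a b : Fin n → Bool} → (not ∘ a) ⊆ (not ∘ b) → b ⊆ a
∁⊆∁⇒⊇ {a = a} {b} sub x bx≡true with a x in ax
... | true  = refl
... | false = contradiction (trans (sym bx≡true) (not-injective (sub x (cong not ax)))) λ ()

-- Boolean factorizations of C_n and antichains

⋁-true⁺ : ∀ {r} (f : Fin r → Bool) t → f t ≡ true → ⋁ r f ≡ true
⋁-true⁺ f zero    ft≡true rewrite ft≡true = refl
⋁-true⁺ f (suc t) ft≡true rewrite ⋁-true⁺ (λ t → f (suc t)) t ft≡true = ∨-zeroʳ (f zero)

⋁-true⁻ : ∀ {r} (f : Fin r → Bool) → ⋁ r f ≡ true → ∃ λ t → f t ≡ true
⋁-true⁻ {suc r} f ⋁≡true with f zero in f0≡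
... | true  = zero , f0≡
... | false = Product.map suc id (⋁-true⁻ (λ t → f (suc t)) ⋁≡true)

⋁-false⁺ : ∀ {r} (f : Fin r → Bool) → (∀ t → f t ≡ false) → ⋁ r f ≡ false
⋁-false⁺ {zero}  f _       = refl
⋁-false⁺ {suc r} f f≡false rewrite f≡false zero = ⋁-false⁺ (λ t → f (suc t)) (f≡false ∘ suc)

⋁-cong : ∀ {r} {f g : Fin r → Bool} → f ≗ g → ⋁ r f ≡ ⋁ r g
⋁-cong {zero}  f≗g = refl
⋁-cong {suc r} f≗g = cong₂ _∨_ (f≗g zero) (⋁-cong (f≗g ∘ suc))

Cmat-diag : ∀ {n} (i : Fin n) → Cmat n i i ≡ false
Cmat-diag i with i ≟ i
... | yes _   = refl
... | no i≢i = contradiction refl i≢i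

Cmat-off : ∀ {n} {i j : Fin n} → i ≢ j → Cmat n i j ≡ true
Cmat-off {i = i} {j} i≢j with i ≟ j
... | yes i≡j = contradiction i≡j i≢j
... | no _    = refl

Cmat-sym : ∀ {n} (i j : Fin n) → Cmat n i j ≡ Cmat n j i
Cmat-sym i j with i ≟ j
... | yes refl = sym (Cmat-diag i)
... | no i≢j   = sym (Cmat-off (i≢j ∘ sym))

factorizable-transpose : ∀ {I J r} {M : Matrix I J} {N : Matrix J I} →
  (∀ i j → N j i ≡ M i j) → BoolFactorizable M r → BoolFactorizable N r
factorizable-transpose N≡Mᵀ (A , B , M≡AB) =
  (λ j t → B t j) , (λ t i → A i t) ,
  λ j i → trans (N≡Mᵀ i j) (trans (M≡AB i j) (⋁-cong (λ t → Bool.∧-comm (A i t) (B t j))))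

complementᵀ : ∀ {n k} → (Fin n → Fin k → Bool) → Fin k → Fin n → Bool
complementᵀ T t j = not (T j t)

⋁-difference≡false⇒⊆ : ∀ {k} (a b : Fin k → Bool) → ⋁ k (λ t → a t ∧ not (b t)) ≡ false → a ⊆ b
⋁-difference≡false⇒⊆ a b ⋁≡false x ax≡true with b x in bx
... | true  = refl
... | false = contradiction (trans (sym ⋁≡false) (⋁-true⁺ _ x (cong₂ (λ u v → u ∧ not v) ax≡true bx))) λ ()

Cmat≡·complementᵀ : ∀ {n k} (T : Fin n → Fin k → Bool) i j → (T i ⊆ T j → i ≡ j) →
  Cmat n i j ≡ (T · complementᵀ T) i j
Cmat≡·complementᵀ T i j isolated with i ≟ j
... | yes refl = sym (⋁-false⁺ _ (λ t → ∧-inverseʳ (T i t)))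
... | no i≢j   = sym (¬-not (i≢j ∘ isolated ∘ ⋁-difference≡false⇒⊆ (T i) (T j)))

Antichain⇒Cmat-factorizable : ∀ {n k} {T : Fin n → Fin k → Bool} → Antichain T → BoolFactorizable (Cmat n) k
Antichain⇒Cmat-factorizable {T = T} antichain =
  T , complementᵀ T , λ i j → Cmat≡·complementᵀ T i j (antichain i j)

Cmat-factor-rows-antichain : ∀ {n s} {A : Matrix (Fin n) (Fin s)} {B} →
  (∀ i j → Cmat n i j ≡ (A · B) i j) → Antichain A
Cmat-factor-rows-antichain C≡AB i j Ai⊆Aj with i ≟ j
... | yes i≡j = i≡j
... | no i≢j  =
  let t , Ait∧Btj≡true = ⋁-true⁻ _ (trans (sym (C≡AB i j)) (Cmat-off i≢j))
      Ajt∧Btj≡true = cong₂ _∧_ (Ai⊆Aj t (∧-conicalˡ _ _ Ait∧Btj≡true)) (∧-conicalʳ _ _ Ait∧Btj≡true)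
  in contradiction (trans (sym (Cmat-diag j)) (trans (C≡AB j j) (⋁-true⁺ _ t Ajt∧Btj≡true))) λ ()

-- Sperner's theorem through the LYM inequality

-- The number of maximal chains ∅ ⊂ … ⊂ [s] passing through a fixed c-set.
lubellWeight : ℕ → ℕ → ℕ
lubellWeight s c = c ! * (s ∸ c) !

lubellWeight-suc : ∀ {s c} → c ≤ s → lubellWeight (suc s) c ≡ (suc s ∸ c) * lubellWeight s c
lubellWeight-suc {s} {c} c≤s = begin
  c ! * (suc s ∸ c) !              ≡⟨ cong (λ d → c ! * d !) [1+s]∸c≡1+[s∸c] ⟩
  c ! * (suc (s ∸ c) * (s ∸ c) !)  ≡⟨ x∙yz≈y∙xz (c !) (suc (s ∸ c)) _ ⟩
  suc (s ∸ c) * lubellWeight s c   ≡⟨ cong (_* lubellWeight s c) [1+s]∸c≡1+[s∸c] ⟨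
  (suc s ∸ c) * lubellWeight s c   ∎
  where
  open ≡-Reasoning
  [1+s]∸c≡1+[s∸c] : suc s ∸ c ≡ suc (s ∸ c)
  [1+s]∸c≡1+[s∸c] = +-∸-assoc 1 c≤s

lubellWeight-split : ∀ {s} (a : Fin (suc s) → Bool) → ¬ Full a →
  lubellWeight (suc s) ∣ a ∣ ≡ sum (λ x → χ (not (a x)) * lubellWeight s ∣ removeAt a x ∣)
lubellWeight-split {s} a ¬full = begin
  lubellWeight (suc s) ∣ a ∣                        ≡⟨ lubellWeight-suc ∣a∣≤s ⟩
  (suc s ∸ ∣ a ∣) * lubellWeight s ∣ a ∣            ≡⟨ cong (_* lubellWeight s ∣ a ∣) (∣∁∣≡n∸∣∣ a) ⟨
  ∣ not ∘ a ∣ * lubellWeight s ∣ a ∣                ≡⟨ *-distribʳ-sum _ (χ ∘ not ∘ a) ⟩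
  sum (λ x → χ (not (a x)) * lubellWeight s ∣ a ∣)  ≡⟨ sum-cong-≗ outside-a ⟩
  sum (λ x → χ (not (a x)) * lubellWeight s ∣ removeAt a x ∣) ∎
  where
  open ≡-Reasoning
  ∣a∣≤s : ∣ a ∣ ≤ s
  ∣a∣≤s = let x , ax≡false = ¬Full⇒∃false a ¬full
          in subst (_≤ s) (∣removeAt∣ a x ax≡false) (∣∣≤n (removeAt a x))
  outside-a : ∀ x → χ (not (a x)) * lubellWeight s ∣ a ∣ ≡ χ (not (a x)) * lubellWeight s ∣ removeAt a x ∣
  outside-a x with a x in ax
  ... | true  = refl
  ... | false = cong (λ c → 1 * lubellWeight s c) (sym (∣removeAt∣ a x ax))

lubellSum : ∀ {n s} → (Fin n → Bool) → (Fin n → Fin s → Bool) → ℕ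
lubellSum {s = s} sel f = sum (λ i → χ (sel i) * lubellWeight s ∣ f i ∣)

-- Subfamilies are given by a selector, so that passing to the members avoiding a point
-- keeps the index set.
AntichainOn : ∀ {n s} → (Fin n → Bool) → (Fin n → Fin s → Bool) → Set
AntichainOn sel f = ∀ i j → sel i ≡ true → sel j ≡ true → f i ⊆ f j → i ≡ j

AntichainOn-removeAt : ∀ {n s} {sel : Fin n → Bool} {f : Fin n → Fin (suc s) → Bool} →
  AntichainOn sel f → ∀ x → AntichainOn (λ i → sel i ∧ not (f i x)) (λ i → removeAt (f i) x)
AntichainOn-removeAt antichain x i j selᵢ selⱼ sub =
  antichain i j (∧-conicalˡ _ _ selᵢ) (∧-conicalˡ _ _ selⱼ) (⊆-removeAt⁻ (not-injective (∧-conicalʳ _ _ selᵢ)) sub)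

lubellSum-fullMember : ∀ {n s} {sel : Fin n → Bool} {f : Fin n → Fin s → Bool} → AntichainOn sel f →
  ∀ {i} → sel i ≡ true → Full (f i) → lubellSum sel f ≡ s !
lubellSum-fullMember {zero} _ {()}
lubellSum-fullMember {suc n} {s} {sel} {f} antichain {i} selᵢ fullᵢ = begin
  lubellSum sel f                 ≡⟨ sum-remove {i = i} term ⟩
  term i + sum (removeAt term i)  ≡⟨ cong₂ _+_ termᵢ≡s! (sum-zero others) ⟩
  s ! + 0                         ≡⟨ +-identityʳ (s !) ⟩
  s !                             ∎
  where
  open ≡-Reasoning
  term : Fin (suc n) → ℕ
  term j = χ (sel j) * lubellWeight s ∣ f j ∣
  others : ∀ j → term (punchIn i j) ≡ 0
  others j with sel (punchIn i j) in selⱼ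
  ... | false = refl
  ... | true  = contradiction (antichain _ i selⱼ selᵢ (λ x _ → fullᵢ x)) (punchInᵢ≢i i j)
  termᵢ≡s! : term i ≡ s !
  termᵢ≡s! = begin
    term i                 ≡⟨ cong₂ (λ b c → χ b * lubellWeight s c) selᵢ (∣full∣ fullᵢ) ⟩
    1 * (s ! * (s ∸ s) !)  ≡⟨ *-identityˡ _ ⟩
    s ! * (s ∸ s) !        ≡⟨ cong (λ d → s ! * d !) (n∸n≡0 s) ⟩
    s ! * 1                ≡⟨ *-identityʳ (s !) ⟩
    s !                    ∎

lubellTerm-split : ∀ {s} b (a : Fin (suc s) → Bool) → (b ≡ true → ¬ Full a) →
  χ b * lubellWeight (suc s) ∣ a ∣ ≡ sum (λ x → χ (b ∧ not (a x)) * lubellWeight s ∣ removeAt a x ∣)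
lubellTerm-split {s} false a _ = sym (sum-replicate-zero (suc s))
lubellTerm-split true  a ¬full = trans (+-identityʳ _) (lubellWeight-split a (¬full refl))

-- Chains through a non-full set a are split by their last new element x ∉ a, and the
-- selected members avoiding x, with x removed, again form an antichain. A full member
-- is the only selected one.
lym : ∀ s {n} (sel : Fin n → Bool) (f : Fin n → Fin s → Bool) → AntichainOn sel f → lubellSum sel f ≤ s !
lym s sel f antichain with any? (λ i → (sel i Bool.≟ true) ×-dec all? (λ x → f i x Bool.≟ true))
... | yes (i , selᵢ , fullᵢ) = ≤-reflexive (lubellSum-fullMember antichain selᵢ fullᵢ)
... | no noneFull = lym-noneFull s sel f antichain (λ i selᵢ fullᵢ → noneFull (i , selᵢ , fullᵢ))
  where
  lym-noneFull : ∀ s {n} (sel : Fin n → Bool) (f : Fin n → Fin s → Bool) → AntichainOn sel f →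
    (∀ i → sel i ≡ true → ¬ Full (f i)) → lubellSum sel f ≤ s !
  lym-noneFull zero sel f _ noneFull = ≤-trans (≤-reflexive (sum-zero unselected)) z≤n
    where
    unselected : ∀ i → χ (sel i) * lubellWeight 0 ∣ f i ∣ ≡ 0
    unselected i with sel i in selᵢ
    ... | false = refl
    ... | true  = contradiction (λ ()) (noneFull i selᵢ)
  lym-noneFull (suc s) sel f antichain noneFull = begin
    lubellSum sel f
      ≡⟨ sum-cong-≗ (λ i → lubellTerm-split (sel i) (f i) (noneFull i)) ⟩
    sum (λ i → sum (λ x → χ (sel i ∧ not (f i x)) * lubellWeight s ∣ removeAt (f i) x ∣))
      ≡⟨ ∑-comm (λ i x → χ (sel i ∧ not (f i x)) * lubellWeight s ∣ removeAt (f i) x ∣) ⟩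
    sum (λ x → lubellSum (λ i → sel i ∧ not (f i x)) (λ i → removeAt (f i) x))
      ≤⟨ sum-mono-≤ (λ x → lym s _ _ (AntichainOn-removeAt antichain x)) ⟩
    sum {suc s} (λ _ → s !)
      ≡⟨ sum-const (suc s) (s !) ⟩
    suc s * s ! ∎
    where open ≤-Reasoning

n∸⌊n/2⌋≡⌈n/2⌉ : ∀ n → n ∸ ⌊ n /2⌋ ≡ ⌈ n /2⌉
n∸⌊n/2⌋≡⌈n/2⌉ n = trans (cong (_∸ ⌊ n /2⌋) (sym (⌊n/2⌋+⌈n/2⌉≡n n))) (m+n∸m≡n ⌊ n /2⌋ ⌈ n /2⌉)

!*!-shift : ∀ {a b} → a ≤ b → suc a ! * b ! ≤ a ! * suc b !
!*!-shift {a} {b} a≤b = begin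
  suc a ! * b !        ≡⟨ *-assoc (suc a) (a !) (b !) ⟩
  suc a * (a ! * b !)  ≤⟨ *-monoˡ-≤ (a ! * b !) (s≤s a≤b) ⟩
  suc b * (a ! * b !)  ≡⟨ x∙yz≈y∙xz (suc b) (a !) (b !) ⟩
  a ! * suc b !        ∎
  where open ≤-Reasoning

balancedFactorials : ℕ → ℕ
balancedFactorials s = ⌊ s /2⌋ ! * ⌈ s /2⌉ !

balancedFactorials-minimal-gap : ∀ a d → balancedFactorials (a + (d + a)) ≤ a ! * (d + a) !
balancedFactorials-minimal-gap a zero =
  ≤-reflexive (cong₂ (λ p q → p ! * q !) (sym (n≡⌊n+n/2⌋ a)) (sym (n≡⌈n+n/2⌉ a)))
balancedFactorials-minimal-gap a (suc zero) = ≤-reflexive (begin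
  balancedFactorials (a + suc a)     ≡⟨ cong balancedFactorials (+-suc a a) ⟩
  ⌈ a + a /2⌉ ! * suc ⌊ a + a /2⌋ !  ≡⟨ cong₂ (λ p q → p ! * suc q !) (sym (n≡⌈n+n/2⌉ a)) (sym (n≡⌊n+n/2⌋ a)) ⟩
  a ! * suc a !                      ∎)
  where open ≡-Reasoning
balancedFactorials-minimal-gap a (suc (suc d)) = begin
  balancedFactorials (a + (2 + d + a))      ≡⟨ cong balancedFactorials a+[2+d+a]≡1+a+[d+1+a] ⟩
  balancedFactorials (suc a + (d + suc a))  ≤⟨ balancedFactorials-minimal-gap (suc a) d ⟩
  suc a ! * (d + suc a) !                   ≡⟨ cong (λ t → suc a ! * t !) (+-suc d a) ⟩
  suc a ! * suc (d + a) !                   ≤⟨ !*!-shift (m≤n⇒m≤1+n (m≤n+m a d)) ⟩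
  a ! * (2 + d + a) !                       ∎
  where
  open ≤-Reasoning
  a+[2+d+a]≡1+a+[d+1+a] : a + (2 + d + a) ≡ suc a + (d + suc a)
  a+[2+d+a]≡1+a+[d+1+a] = trans (+-suc a (suc (d + a))) (cong (λ t → suc (a + t)) (sym (+-suc d a)))

balancedFactorials-minimal : ∀ a b → balancedFactorials (a + b) ≤ a ! * b !
balancedFactorials-minimal a b =
  [ ordered , (λ b≤a → subst₂ _≤_ (cong balancedFactorials (+-comm b a)) (*-comm (b !) (a !)) (ordered b≤a)) ]′
  (≤-total a b)
  where
  ordered : ∀ {a b} → a ≤ b → balancedFactorials (a + b) ≤ a ! * b !
  ordered {a} {b} a≤b = subst (λ c → balancedFactorials (a + c) ≤ a ! * c !) (m∸n+n≡m a≤b)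
                          (balancedFactorials-minimal-gap a (b ∸ a))

lubellWeight-central-minimal : ∀ {s c} → c ≤ s → lubellWeight s ⌊ s /2⌋ ≤ lubellWeight s c
lubellWeight-central-minimal {s} {c} c≤s = begin
  lubellWeight s ⌊ s /2⌋            ≡⟨ cong (λ d → ⌊ s /2⌋ ! * d !) (n∸⌊n/2⌋≡⌈n/2⌉ s) ⟩
  balancedFactorials s              ≡⟨ cong balancedFactorials (m+[n∸m]≡n c≤s) ⟨
  balancedFactorials (c + (s ∸ c))  ≤⟨ balancedFactorials-minimal c (s ∸ c) ⟩
  lubellWeight s c                  ∎
  where open ≤-Reasoning

C*lubellWeight≡! : ∀ {n k} → k ≤ n → (n C k) * lubellWeight n k ≡ n !
C*lubellWeight≡! {n} {k} k≤n =
  trans (cong (_* lubellWeight n k) (nCk≡n!/k![n-k]! k≤n)) (m/n*n≡m (k![n∸k]!∣n! k≤n))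
  where instance _ = k !* (n ∸ k) !≢0

sperner : ∀ {s n} (f : Fin n → Fin s → Bool) → Antichain f → n ≤ s C ⌊ s /2⌋
sperner {s} {n} f antichain = *-cancelʳ-≤ n (s C m) (lubellWeight s m) (begin
  n * lubellWeight s m                ≡⟨ sum-const n _ ⟨
  sum {n} (λ _ → lubellWeight s m)    ≤⟨ sum-mono-≤ (λ i → lubellWeight-central-minimal (∣∣≤n (f i))) ⟩
  sum (λ i → lubellWeight s ∣ f i ∣)  ≡⟨ sum-cong-≗ (λ i → *-identityˡ (lubellWeight s ∣ f i ∣)) ⟨
  lubellSum (λ _ → true) f            ≤⟨ lym s _ f (λ i j _ _ → antichain i j) ⟩
  s !                                 ≡⟨ C*lubellWeight≡! (⌊n/2⌋≤n s) ⟨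
  (s C m) * lubellWeight s m          ∎)
  where
  open ≤-Reasoning
  m : ℕ
  m = ⌊ s /2⌋
  instance _ = m !* (s ∸ m) !≢0

Cmat-factorizable⇒≤centralBinomial : ∀ {n s} → BoolFactorizable (Cmat n) s → n ≤ s C ⌊ s /2⌋
Cmat-factorizable⇒≤centralBinomial (A , _ , C≡AB) = sperner A (Cmat-factor-rows-antichain C≡AB)

nCk≤[1+n]Ck : ∀ n k → n C k ≤ suc n C k
nCk≤[1+n]Ck n zero    = ≤-refl
nCk≤[1+n]Ck n (suc k) = ≤-trans (m≤n+m (n C suc k) (n C k)) (≤-reflexive (nCk+nC[k+1]≡[n+1]C[k+1] n k))

centralBinomial-step : ∀ n → n C ⌊ n /2⌋ ≤ suc n C ⌊ suc n /2⌋
centralBinomial-step n = begin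
  n C ⌊ n /2⌋         ≡⟨ nCk≡nC[n∸k] (⌊n/2⌋≤n n) ⟩
  n C (n ∸ ⌊ n /2⌋)   ≡⟨ cong (n C_) (n∸⌊n/2⌋≡⌈n/2⌉ n) ⟩
  n C ⌈ n /2⌉         ≤⟨ nCk≤[1+n]Ck n ⌈ n /2⌉ ⟩
  suc n C ⌈ n /2⌉     ∎
  where open ≤-Reasoning

centralBinomial-mono : ∀ {m n} → m ≤ n → m C ⌊ m /2⌋ ≤ n C ⌊ n /2⌋
centralBinomial-mono = mono′ ∘ ≤⇒≤′
  where
  mono′ : ∀ {m n} → m ≤′ n → m C ⌊ m /2⌋ ≤ n C ⌊ n /2⌋
  mono′ ≤′-refl            = ≤-refl
  mono′ (≤′-step {n} m≤′n) = ≤-trans (mono′ m≤′n) (centralBinomial-step n)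

-- An antichain of k C ⌊k/2⌋ nonempty sets

splitPascal : ∀ n m → Fin (suc n C suc m) → Fin (n C m) ⊎ Fin (n C suc m)
splitPascal n m = splitAt (n C m) ∘ cast (sym (nCk+nC[k+1]≡[n+1]C[k+1] n m))

splitPascal-injective : ∀ n m {i j} → splitPascal n m i ≡ splitPascal n m j → i ≡ j
splitPascal-injective n m {i} {j} eq = begin
  i                        ≡⟨ cast-involutive pascal (sym pascal) i ⟨
  cast pascal (cast _ i)   ≡⟨ cong (cast pascal) (begin
    cast _ i                      ≡⟨ join-splitAt (n C m) _ _ ⟨
    join _ _ (splitPascal n m i)  ≡⟨ cong (join _ _) eq ⟩
    join _ _ (splitPascal n m j)  ≡⟨ join-splitAt (n C m) _ _ ⟩
    cast _ j                      ∎) ⟩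
  cast pascal (cast _ j)   ≡⟨ cast-involutive pascal (sym pascal) j ⟩
  j                        ∎
  where
  open ≡-Reasoning
  pascal : n C m + n C suc m ≡ suc n C suc m
  pascal = nCk+nC[k+1]≡[n+1]C[k+1] n m

subsetOfSize : ∀ n m → Fin (n C m) → Fin n → Bool
subsetOfSize n       zero    _ = ∅
subsetOfSize zero    (suc m) ()
subsetOfSize (suc n) (suc m) i with splitPascal n m i
... | inj₁ j = true  ∷ subsetOfSize n m j
... | inj₂ j = false ∷ subsetOfSize n (suc m) j

∣subsetOfSize∣ : ∀ n m i → ∣ subsetOfSize n m i ∣ ≡ m
∣subsetOfSize∣ n       zero    _ = sum-replicate-zero n
∣subsetOfSize∣ (suc n) (suc m) i with splitPascal n m i
... | inj₁ j = cong suc (∣subsetOfSize∣ n m j)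
... | inj₂ j = ∣subsetOfSize∣ n (suc m) j

subsetOfSize-injective : ∀ n m {i j} → subsetOfSize n m i ≗ subsetOfSize n m j → i ≡ j
subsetOfSize-injective n       zero    {zero} {zero} _ = refl
subsetOfSize-injective (suc n) (suc m) {i} {j} eq with splitPascal n m i in eqᵢ | splitPascal n m j in eqⱼ
... | inj₁ i′ | inj₁ j′ = splitPascal-injective n m (trans eqᵢ (trans (cong inj₁ (subsetOfSize-injective n m (eq ∘ suc))) (sym eqⱼ)))
... | inj₂ i′ | inj₂ j′ = splitPascal-injective n m (trans eqᵢ (trans (cong inj₂ (subsetOfSize-injective n (suc m) (eq ∘ suc))) (sym eqⱼ)))
... | inj₁ _  | inj₂ _  = contradiction (eq zero) λ ()
... | inj₂ _  | inj₁ _  = contradiction (eq zero) λ ()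

-- Complements of the ⌊k/2⌋-subsets, so that every member is nonempty once k ≥ 1.
centralFamily : ∀ k → Fin (k C ⌊ k /2⌋) → Fin k → Bool
centralFamily k i = not ∘ subsetOfSize k ⌊ k /2⌋ i

centralFamily-antichain : ∀ k → Antichain (centralFamily k)
centralFamily-antichain k i j sub = sym (subsetOfSize-injective k ⌊ k /2⌋
  (⊆∧∣∣≡⇒≗ (∁⊆∁⇒⊇ sub) (trans (∣subsetOfSize∣ k ⌊ k /2⌋ j) (sym (∣subsetOfSize∣ k ⌊ k /2⌋ i)))))

centralFamily-nonempty : ∀ {k} → 1 ≤ k → ∀ i → Nonempty (centralFamily k i)
centralFamily-nonempty {suc k} _ i = Product.map₂ (cong not) (¬Full⇒∃false (subsetOfSize (suc k) m i)
  (λ full → <⇒≢ (⌊n/2⌋<n k) (trans (sym (∣subsetOfSize∣ (suc k) m i)) (∣full∣ full))))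
  where m : ℕ
        m = ⌊ suc k /2⌋

-- Factorizations of C_(N+1) and of its proper sub-matrices

adjoinSingleton : ∀ {N k} → (Fin N → Fin k → Bool) → Fin (suc N) → Fin (suc k) → Bool
adjoinSingleton S = (true ∷ ∅) ∷ (λ i → false ∷ S i)

adjoinSingleton-antichain : ∀ {N k} {S : Fin N → Fin k → Bool} → Antichain S → (∀ i → Nonempty (S i)) →
  Antichain (adjoinSingleton S)
adjoinSingleton-antichain _ _ zero zero _ = refl
adjoinSingleton-antichain _ _ zero (suc j) sub = contradiction (sub zero refl) λ ()
adjoinSingleton-antichain _ nonempty (suc i) zero sub =
  let x , Sᵢx≡true = nonempty i in contradiction (sub (suc x) Sᵢx≡true) λ ()
adjoinSingleton-antichain antichain _ (suc i) (suc j) sub = cong suc (antichain i j (sub ∘ suc))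

∅∷-antichain-off-zero : ∀ {N k} {S : Fin N → Fin k → Bool} → Antichain S → (∀ i → Nonempty (S i)) →
  ∀ p j → p ≢ zero → (∅ ∷ S) p ⊆ (∅ ∷ S) j → p ≡ j
∅∷-antichain-off-zero _ _ zero _ p≢0 _ = contradiction refl p≢0
∅∷-antichain-off-zero _ nonempty (suc i) zero _ sub =
  let x , Sᵢx≡true = nonempty i in contradiction (sub x Sᵢx≡true) λ ()
∅∷-antichain-off-zero antichain _ (suc i) (suc j) _ sub = cong suc (antichain i j sub)

-- The transposition m ↔ 0 gives the missing row m the empty set, which makes column m of
-- the product all ones; every other row gets a nonempty member of S.
subMatrix-factorizable-missingRow : ∀ {N k} {S : Fin N → Fin k → Bool} → Antichain S → (∀ i → Nonempty (S i)) →
  ∀ {R R′ m} → m ∉ R → BoolFactorizable (subMatrix (Cmat (suc N)) R R′) k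
subMatrix-factorizable-missingRow {S = S} antichain nonempty {R} {m = m} m∉R =
  (λ (i , _) → T i) , (λ t (j , _) → complementᵀ T t j) ,
  λ (i , i∈R) (j , _) → Cmat≡·complementᵀ T i j (isolated (λ { refl → m∉R i∈R }))
  where
  σ τ : Fin _ → Fin _
  σ = Components.transpose m zero
  τ = Components.transpose zero m
  τσ≡id : ∀ i → τ (σ i) ≡ i
  τσ≡id i = Components.transpose-inverse zero m
  T : Fin (suc _) → Fin _ → Bool
  T = (∅ ∷ S) ∘ σ
  isolated : ∀ {i j} → i ≢ m → T i ⊆ T j → i ≡ j
  isolated {i} {j} i≢m T⊆T =
    trans (sym (τσ≡id i)) (trans (cong τ (∅∷-antichain-off-zero antichain nonempty (σ i) (σ j) σi≢0 T⊆T)) (τσ≡id j))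
    where σi≢0 : σ i ≢ zero
          σi≢0 σi≡0 = i≢m (trans (sym (τσ≡id i)) (cong τ σi≡0))

≡⊤⊎missing : ∀ {n} (R : Subset n) → R ≡ ⊤ ⊎ ∃ (_∉ R)
≡⊤⊎missing R with all? (_∈? R)
... | yes all∈R = inj₁ (⊆-antisym ⊆⊤ (λ {x} _ → all∈R x))
... | no ¬all∈R = inj₂ (¬∀⟶∃¬ _ _ (_∈? R) ¬all∈R)

Proper⇒missing : ∀ {n} {R R′ : Subset n} → Proper R R′ → ∃ (_∉ R) ⊎ ∃ (_∉ R′)
Proper⇒missing {R = R} {R′} proper with ≡⊤⊎missing R | ≡⊤⊎missing R′
... | inj₂ missingRow | _                  = inj₁ missingRow
... | inj₁ _          | inj₂ missingColumn = inj₂ missingColumn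
... | inj₁ R≡⊤        | inj₁ R′≡⊤          = contradiction (R≡⊤ , R′≡⊤) proper

Cmat-proper-rank≤ : ∀ {N k} {S : Fin N → Fin k → Bool} → Antichain S → (∀ i → Nonempty (S i)) →
  (R R′ : Subset (suc N)) → Proper R R′ → BoolRank≤ (subMatrix (Cmat (suc N)) R R′) k
Cmat-proper-rank≤ {N} {k} antichain nonempty R R′ proper =
  k , ≤-refl , [ missingRow , missingColumn ]′ (Proper⇒missing proper)
  where
  missingRow : ∃ (_∉ R) → BoolFactorizable (subMatrix (Cmat (suc N)) R R′) k
  missingRow (_ , m∉R) = subMatrix-factorizable-missingRow antichain nonempty m∉R
  missingColumn : ∃ (_∉ R′) → BoolFactorizable (subMatrix (Cmat (suc N)) R R′) k
  missingColumn (_ , m∉R′) = factorizable-transpose (λ (j , _) (i , _) → Cmat-sym i j)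
                               (subMatrix-factorizable-missingRow antichain nonempty m∉R′)

n/2≡⌊n/2⌋ : ∀ n → n / 2 ≡ ⌊ n /2⌋
n/2≡⌊n/2⌋ 0             = refl
n/2≡⌊n/2⌋ 1             = refl
n/2≡⌊n/2⌋ (suc (suc n)) = trans (m/n≡1+[m∸n]/n {suc (suc n)} {2} (s≤s (s≤s z≤n))) (cong suc (n/2≡⌊n/2⌋ n))

mainTheorem9 : (k : ℕ) → 1 ≤ k →
    BoolRank≡ (Cmat (suc (k C (k / 2)))) (suc k)
    × ((R S : Subset (suc (k C (k / 2)))) → Proper R S →
       BoolRank≤ (subMatrix (Cmat (suc (k C (k / 2)))) R S) k)
mainTheorem9 k 1≤k rewrite n/2≡⌊n/2⌋ k =
  (Antichain⇒Cmat-factorizable (adjoinSingleton-antichain antichain nonempty) , minimal) ,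
  Cmat-proper-rank≤ antichain nonempty
  where
  antichain : Antichain (centralFamily k)
  antichain = centralFamily-antichain k
  nonempty : ∀ i → Nonempty (centralFamily k i)
  nonempty = centralFamily-nonempty 1≤k
  minimal : ∀ s → BoolFactorizable (Cmat (suc (k C ⌊ k /2⌋))) s → suc k ≤ s
  minimal s F = ≮⇒≥ λ s<1+k →
    1+n≰n (≤-trans (Cmat-factorizable⇒≤centralBinomial F) (centralBinomial-mono {s} {k} (≤-pred s<1+k)))
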